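{- Let $d\ge 3$ and $n\ge 4$ be integers. If $d$ is even, then $\gamma(cDB^+(d,3,n))=d(d-2)^{n-2}$. If $d$ is odd, then $$d(d-2)^{n-2}\le \gamma(cDB^+(d,3,n))\le (d-1)^2(d-2)^{n-3},$$ and this upper bound equals $\bigl(1+\Theta(1/d^2)\bigr)d(d-2)^{n-2}$.
   Context: Let $[d]=\{1,\dots,d\}$. A sequence $(x_1,\dots,x_n)\in[d]^n$ is $t$-constrained if for all $1\le i<j\le n$ with $x_i=x_j$ one has $j-i\ge t$. For $1\le t\le\min\{d,n\}$, $V(d,t,n)$ denotes the set of $t$-constrained sequences in $[d]^n$. The directed $t$-constrained de Bruijn graph $cDB^+(d,t,n)$ has vertex set $V(d,t,n)$ and an arc from $(a_1,\dots,a_n)$ to $(a_2,\dots,a_n,a_{n+1})$ whenever both sequences lie in $V(d,t,n)$ (the subgraph of the directed de Bruijn graph induced by $V(d,t,n)$). In a directed graph a vertex dominates itself and its out-neighbours; a dominating set is a set $S$ of vertices such that every vertex is dominated by some vertex of $S$, and $\gamma(G)$ is the minimum size of a dominating set. -}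

module Defs where

open import Data.Nat using (ℕ; _≤_; _<_; _∸_)
open import Data.Fin using (Fin; toℕ)
open import Data.Vec using (Vec; lookup; _∷_; _∷ʳ_)
open import Data.List using (List; length)
open import Data.List.Relation.Unary.All using (All)
open import Data.List.Relation.Unary.Any using (Any)
open import Data.List.Relation.Unary.Unique.Propositional using (Unique)
open import Data.Product using (Σ; ∃-syntax; _×_)
open import Data.Sum using (_⊎_)
open import Relation.Binary.PropositionalEquality using (_≡_)

Seq : ℕ → ℕ → Set
Seq d n = Vec (Fin d) n

Constrained : ∀ {d n} → ℕ → Seq d n → Set
Constrained {d} {n} t x =
  (i j : Fin n) → toℕ i < toℕ j → lookup x i ≡ lookup x j → t ≤ toℕ j ∸ toℕ i

-- Arc of cDB⁺(d,t,n): (a₁,…,aₙ) → (a₂,…,aₙ,aₙ₊₁), both endpoints t-constrained.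
-- x ∷ʳ a ≡ b ∷ y  says exactly that y is x shifted left with a appended.
Arc : ∀ {d n} → ℕ → Seq d n → Seq d n → Set
Arc {d} t x y =
  Constrained t x × Constrained t y × (∃[ a ] ∃[ b ] (x ∷ʳ a ≡ b ∷ y))

Dominated : ∀ {d n} → ℕ → List (Seq d n) → Seq d n → Set
Dominated t S v = Any (λ s → s ≡ v ⊎ Arc t s v) S

IsDominatingSet : (d t n : ℕ) → List (Seq d n) → Set
IsDominatingSet d t n S =
  All (Constrained t) S × Unique S ×
  ((v : Seq d n) → Constrained t v → Dominated t S v)

DominationNumberIs : (d t n : ℕ) → ℕ → Set
DominationNumberIs d t n k =
  Σ (List (Seq d n)) (λ S → IsDominatingSet d t n S × length S ≡ k) ×
  ((S : List (Seq d n)) → IsDominatingSet d t n S → k ≤ length S)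

DominationNumberAtLeast : (d t n : ℕ) → ℕ → Set
DominationNumberAtLeast d t n k =
  (S : List (Seq d n)) → IsDominatingSet d t n S → k ≤ length S

DominationNumberAtMost : (d t n : ℕ) → ℕ → Set
DominationNumberAtMost d t n k =
  Σ (List (Seq d n)) (λ S → IsDominatingSet d t n S × length S ≤ k)

-- A vertex of cDB⁺(d,3,n) dominates at most d − 1 vertices (itself and its
-- d − 2 out-neighbours), while there are d(d−1)(d−2)^(n−2) vertices; this gives
-- the lower bound.  For the upper bounds fix an involution σ of the alphabet.
-- A vertex (x, y, …) with y ≠ σx is an out-neighbour of (σx, x, y, …), so the
-- vertices starting with a pair (a, σa) dominate everything as soon as σ has no
-- fixed point, which is possible exactly when d is even.  For odd d, σ must
-- fix a letter z; the vertices starting with z are then dominated by the extra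
-- vertices (σy, z, y, …).
module Submission where

open import Defs
open import Data.Fin using (Fin; zero; suc; punchIn; punchOut)
open import Data.Fin.Properties
  using (_≟_; punchIn-injective; punchInᵢ≢i; punchIn-punchOut; punchOut-injective)
  renaming (suc-injective to Fin-suc-injective)
open import Data.List using (List; []; _∷_; _++_; map; length; allFin; removeAt)
open import Data.List.Membership.Propositional using (_∈_; find)
open import Data.List.Membership.Propositional.Properties
  using (∈-map⁺; ∈-map⁻; ∈-++⁺ˡ; ∈-++⁺ʳ; ∈-++⁻; ∈-allFin)
open import Data.List.Properties using (length-map; length-++; length-tabulate; length-removeAt′)
open import Data.List.Relation.Binary.Disjoint.Propositional using (Disjoint)
open import Data.List.Relation.Binary.Subset.Propositional using (_⊆_)
open import Data.List.Relation.Unary.All as All using (All; []; _∷_)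
import Data.List.Relation.Unary.All.Properties as All
open import Data.List.Relation.Unary.Any as Any using (here; there)
open import Data.List.Relation.Unary.Unique.Propositional using (Unique; []; _∷_)
import Data.List.Relation.Unary.Unique.Propositional.Properties as Unique
open import Data.Nat
  using (ℕ; zero; suc; _+_; _*_; _∸_; _^_; _≤_; _≤′_; ≤′-refl; ≤′-step; z≤n; s≤s)
open import Data.Nat.Divisibility using (_∣_; divides)
open import Data.Nat.Properties
  using (≤′⇒≤; ≤⇒≤′; ≤-trans; ≤-refl; ≤-reflexive; m≤n⇒m≤1+n; n∸n≡0; +-∸-assoc;
         *-identityˡ; *-zeroʳ; *-suc; *-assoc; *-comm; *-cancelˡ-≤; module ≤-Reasoning)
open import Data.Nat.Tactic.RingSolver using (solve-∀)
open import Data.Product using (Σ; ∃-syntax; _×_; _,_; proj₁; proj₂; map₁)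
open import Data.Sum using (_⊎_; inj₁; inj₂; [_,_]′)
open import Data.Unit using (⊤; tt)
open import Data.Vec using (Vec; []; _∷_; _∷ʳ_; head; tail; initLast)
open import Data.Vec.Properties using (∷ʳ-injectiveˡ; ∷ʳ-injectiveʳ; ∷-injectiveʳ)
open import Function using (id; _∘_)
open import Relation.Nullary using (¬_; yes; no; contradiction)
open import Relation.Binary.PropositionalEquality
  using (_≡_; _≢_; refl; sym; trans; cong; cong₂; subst; ≢-sym; module ≡-Reasoning)

module _ {A : Set} where

  ∈-removeAt : ∀ {x y : A} {ys} (x∈ys : x ∈ ys) → y ∈ ys → y ≢ x →
               y ∈ removeAt ys (Any.index x∈ys)
  ∈-removeAt (here refl) (here refl) y≢x = contradiction refl y≢x
  ∈-removeAt (here refl) (there y∈ys) _  = y∈ys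
  ∈-removeAt (there _)   (here refl) _   = here refl
  ∈-removeAt (there x∈ys) (there y∈ys) y≢x = there (∈-removeAt x∈ys y∈ys y≢x)

  unique-⊆⇒length≤ : ∀ {xs ys : List A} → Unique xs → xs ⊆ ys → length xs ≤ length ys
  unique-⊆⇒length≤ {[]} _ _ = z≤n
  unique-⊆⇒length≤ {x ∷ xs} {ys} (x∉xs ∷ xs!) xs⊆ys =
    subst (suc (length xs) ≤_) (sym (length-removeAt′ ys (Any.index x∈ys)))
      (s≤s (unique-⊆⇒length≤ xs! λ y∈xs →
        ∈-removeAt x∈ys (xs⊆ys (there y∈xs)) λ y≡x → All.lookup x∉xs y∈xs (sym y≡x)))
    where
    x∈ys : x ∈ ys
    x∈ys = xs⊆ys (here refl)

module _ {k : ℕ} where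

  others : Fin (suc k) → List (Fin (suc k))
  others x = map (punchIn x) (allFin k)

  length-others : ∀ x → length (others x) ≡ k
  length-others x = trans (length-map (punchIn x) (allFin k)) (length-tabulate id)

  ∈-others⁺ : ∀ {a x} → a ≢ x → a ∈ others x
  ∈-others⁺ {a} {x} a≢x =
    subst (_∈ others x) (punchIn-punchOut (≢-sym a≢x)) (∈-map⁺ (punchIn x) (∈-allFin _))

  ∈-others⁻ : ∀ {a x} → a ∈ others x → a ≢ x
  ∈-others⁻ {x = x} a∈ with ∈-map⁻ (punchIn x) a∈
  ... | i , _ , refl = punchInᵢ≢i x i

  others-unique : ∀ x → Unique (others x)
  others-unique x = Unique.map⁺ (punchIn-injective x _ _) (Unique.allFin⁺ k)

module _ {k : ℕ} where

  others₂ : (x y : Fin (suc (suc k))) → x ≢ y → List (Fin (suc (suc k)))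
  others₂ x y x≢y = map (punchIn x) (others (punchOut x≢y))

  length-others₂ : ∀ x y (x≢y : x ≢ y) → length (others₂ x y x≢y) ≡ k
  length-others₂ x y x≢y =
    trans (length-map (punchIn x) (others (punchOut x≢y))) (length-others (punchOut x≢y))

  ∈-others₂⁺ : ∀ {a x y} {x≢y : x ≢ y} → a ≢ x → a ≢ y → a ∈ others₂ x y x≢y
  ∈-others₂⁺ {a} {x} {y} {x≢y} a≢x a≢y =
    subst (_∈ others₂ x y x≢y) (punchIn-punchOut x≢a)
      (∈-map⁺ (punchIn x) (∈-others⁺ (a≢y ∘ punchOut-injective x≢a x≢y)))
    where x≢a = ≢-sym a≢x

  ∈-others₂⁻ : ∀ {a x y} {x≢y : x ≢ y} → a ∈ others₂ x y x≢y → a ≢ x × a ≢ y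
  ∈-others₂⁻ {x = x} {x≢y = x≢y} a∈ with ∈-map⁻ (punchIn x) a∈
  ... | b , b∈ , refl = punchInᵢ≢i x b , λ eq →
    ∈-others⁻ b∈ (punchIn-injective x b _ (trans eq (sym (punchIn-punchOut x≢y))))

  others₂-unique : ∀ x y (x≢y : x ≢ y) → Unique (others₂ x y x≢y)
  others₂-unique x y x≢y = Unique.map⁺ (punchIn-injective x _ _) (others-unique _)

module _ {A : Set} where

  Apart : ∀ {n} → A → Vec A n → Set
  Apart x []          = ⊤
  Apart x (y ∷ [])    = x ≢ y
  Apart x (y ∷ z ∷ _) = x ≢ y × x ≢ z

  Fresh : ∀ {n} → A → Vec A n → Set
  Fresh a []              = ⊤
  Fresh a (x ∷ [])        = a ≢ x
  Fresh a (x ∷ y ∷ [])    = a ≢ x × a ≢ y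
  Fresh a (x ∷ y ∷ z ∷ w) = Fresh a (y ∷ z ∷ w)

  -- Any three consecutive entries are pairwise distinct: the local form of being
  -- 3-constrained.
  Spaced : ∀ {n} → Vec A n → Set
  Spaced []      = ⊤
  Spaced (x ∷ w) = Apart x w × Spaced w

  apart-head : ∀ {n x y} (w : Vec A n) → Apart x (y ∷ w) → x ≢ y
  apart-head []      x≢y        = x≢y
  apart-head (_ ∷ _) (x≢y , _) = x≢y

  spaced-∷ʳ⁺ : ∀ {n} (w : Vec A n) {a} → Spaced w → Fresh a w → Spaced (w ∷ʳ a)
  spaced-∷ʳ⁺ []              _               _            = tt , tt
  spaced-∷ʳ⁺ (x ∷ [])        _               a≢x          = ≢-sym a≢x , tt , tt
  spaced-∷ʳ⁺ (x ∷ y ∷ [])    (x≢y , s)       (a≢x , a≢y)  = (x≢y , ≢-sym a≢x) , spaced-∷ʳ⁺ (y ∷ []) s a≢y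
  spaced-∷ʳ⁺ (x ∷ y ∷ z ∷ w) (x-apart , s)   fresh        = x-apart , spaced-∷ʳ⁺ (y ∷ z ∷ w) s fresh

  spaced-∷ʳ⁻ : ∀ {n} (w : Vec A n) {a} → Spaced (w ∷ʳ a) → Spaced w × Fresh a w
  spaced-∷ʳ⁻ []              _                             = tt , tt
  spaced-∷ʳ⁻ (x ∷ [])        (x≢a , _)                     = (tt , tt) , ≢-sym x≢a
  spaced-∷ʳ⁻ (x ∷ y ∷ [])    ((x≢y , x≢a) , y≢a , _)       = (x≢y , tt , tt) , ≢-sym x≢a , ≢-sym y≢a
  spaced-∷ʳ⁻ (x ∷ y ∷ z ∷ w) (x-apart , s) = map₁ (x-apart ,_) (spaced-∷ʳ⁻ (y ∷ z ∷ w) s)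

  data _≼_ : ∀ {j n} → Vec A j → Vec A n → Set where
    []≼ : ∀ {n} {v : Vec A n} → [] ≼ v
    ∷≼  : ∀ {j n} {x} {q : Vec A j} {v : Vec A n} → q ≼ v → (x ∷ q) ≼ (x ∷ v)

  ≼⇒≡ : ∀ {j} {q v : Vec A j} → q ≼ v → q ≡ v
  ≼⇒≡ {v = []}  []≼      = refl
  ≼⇒≡ (∷≼ q≼v) = cong (_ ∷_) (≼⇒≡ q≼v)

  ≼-∷ʳ⁻ : ∀ {j n} {q : Vec A j} (w : Vec A n) {a} → q ≼ (w ∷ʳ a) → j ≤ n → q ≼ w
  ≼-∷ʳ⁻ []      []≼      _         = []≼
  ≼-∷ʳ⁻ []      (∷≼ _)   ()
  ≼-∷ʳ⁻ (_ ∷ _) []≼      _         = []≼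
  ≼-∷ʳ⁻ (_ ∷ w) (∷≼ q≼v) (s≤s j≤n) = ∷≼ (≼-∷ʳ⁻ w q≼v j≤n)

  apart-≼ : ∀ {j n x} {q : Vec A j} {v : Vec A n} → q ≼ v → Apart x v → Apart x q
  apart-≼                  []≼            _        = tt
  apart-≼ {v = _ ∷ w}      (∷≼ []≼)       x-apart  = apart-head w x-apart
  apart-≼                  (∷≼ (∷≼ _))    x-apart  = x-apart

  spaced-≼ : ∀ {j n} {q : Vec A j} {v : Vec A n} → q ≼ v → Spaced v → Spaced q
  spaced-≼ []≼             _               = tt
  spaced-≼ (∷≼ q≼v)        (x-apart , s)   = apart-≼ q≼v x-apart , spaced-≼ q≼v s

module _ {d : ℕ} where

  constrained-tail : ∀ {t n x} {w : Seq d n} → Constrained t (x ∷ w) → Constrained t w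
  constrained-tail c i j i<j = c (suc i) (suc j) (s≤s i<j)

  constrained⇒spaced : ∀ {n} (v : Seq d n) → Constrained 3 v → Spaced v
  constrained⇒spaced []      _ = tt
  constrained⇒spaced (x ∷ w) c = apart w c , constrained⇒spaced w (constrained-tail c)
    where
    apart₁ : ∀ {n y} {w : Seq d n} → Constrained 3 (x ∷ y ∷ w) → x ≢ y
    apart₁ c x≡y with c zero (suc zero) (s≤s z≤n) x≡y
    ... | s≤s ()
    apart₂ : ∀ {n y z} {w : Seq d n} → Constrained 3 (x ∷ y ∷ z ∷ w) → x ≢ z
    apart₂ c x≡z with c zero (suc (suc zero)) (s≤s z≤n) x≡z
    ... | s≤s (s≤s ())
    apart : ∀ {n} (w : Seq d n) → Constrained 3 (x ∷ w) → Apart x w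
    apart []          _ = tt
    apart (_ ∷ [])    c = apart₁ c
    apart (_ ∷ _ ∷ _) c = apart₁ c , apart₂ c

  ∷-constrained : ∀ {n} x (w : Seq d n) → Apart x w → Constrained 3 w → Constrained 3 (x ∷ w)
  ∷-constrained x w           x-apart c zero    zero                      ()
  ∷-constrained x (_ ∷ w)     x-apart c zero    (suc zero)                _ x≡y = contradiction x≡y (apart-head w x-apart)
  ∷-constrained x (_ ∷ _ ∷ _) x-apart c zero    (suc (suc zero))          _ x≡z = contradiction x≡z (proj₂ x-apart)
  ∷-constrained x (_ ∷ _ ∷ _) x-apart c zero    (suc (suc (suc _)))       _ _   = s≤s (s≤s (s≤s z≤n))
  ∷-constrained x w           x-apart c (suc i) zero                      ()
  ∷-constrained x (_ ∷ w)     x-apart c (suc i) (suc j)                   (s≤s i<j) = c i j i<j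

  spaced⇒constrained : ∀ {n} (v : Seq d n) → Spaced v → Constrained 3 v
  spaced⇒constrained []      _             = λ ()
  spaced⇒constrained (x ∷ w) (x-apart , s) = ∷-constrained x w x-apart (spaced⇒constrained w s)

  prepend-arc : ∀ {n b a} {w : Seq d n} → Spaced (b ∷ w) → Spaced (w ∷ʳ a) → Arc 3 (b ∷ w) (w ∷ʳ a)
  prepend-arc {b = b} {a} s s′ = spaced⇒constrained _ s , spaced⇒constrained _ s′ , a , b , refl

  arc-target : ∀ {t n} {s v : Seq d (suc n)} → Arc t s v → ∃[ a ] v ≡ tail s ∷ʳ a
  arc-target {s = _ ∷ _} (_ , _ , a , _ , eq) = a , sym (∷-injectiveʳ eq)

  dominated-by-self : ∀ {n S} {v : Seq d n} → v ∈ S → Dominated 3 S v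
  dominated-by-self = Any.map λ { refl → inj₁ refl }

  dominated-via-arc : ∀ {n S} {s v : Seq d n} → s ∈ S → Arc 3 s v → Dominated 3 S v
  dominated-via-arc s∈S arc = Any.map (λ { refl → inj₂ arc }) s∈S

  isDominatingSet : ∀ {n} {S : List (Seq d (suc n))} → All Spaced S → Unique S →
    (∀ w a → Spaced (w ∷ʳ a) → Dominated 3 S (w ∷ʳ a)) → IsDominatingSet d 3 (suc n) S
  isDominatingSet {S = S} S-spaced S! dominated =
    All.map (spaced⇒constrained _) S-spaced , S! , dominates
    where
    dominates : ∀ v → Constrained 3 v → Dominated 3 S v
    dominates v c with initLast v
    ... | w , a , refl = dominated w a (constrained⇒spaced (w ∷ʳ a) c)

module Sequences (m : ℕ) where

  D : ℕ
  D = suc (suc m)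

  successors : ∀ {n} → Seq D n → List (Fin D)
  successors []              = allFin D
  successors (x ∷ [])        = others x
  successors (x ∷ y ∷ []) with x ≟ y
  ... | yes _   = []
  ... | no x≢y  = others₂ x y x≢y
  successors (x ∷ y ∷ z ∷ w) = successors (y ∷ z ∷ w)

  ∈-successors⁺ : ∀ {n a} (w : Seq D n) → Spaced w → Fresh a w → a ∈ successors w
  ∈-successors⁺ []              _ _     = ∈-allFin _
  ∈-successors⁺ (x ∷ [])        _ a≢x   = ∈-others⁺ a≢x
  ∈-successors⁺ (x ∷ y ∷ []) (x≢y , _) (a≢x , a≢y) with x ≟ y
  ... | yes x≡y = contradiction x≡y x≢y
  ... | no _    = ∈-others₂⁺ a≢x a≢y
  ∈-successors⁺ (x ∷ y ∷ z ∷ w) (_ , s) fresh = ∈-successors⁺ (y ∷ z ∷ w) s fresh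

  ∈-successors⁻ : ∀ {n a} (w : Seq D n) → a ∈ successors w → Fresh a w
  ∈-successors⁻ []              _  = tt
  ∈-successors⁻ (x ∷ [])        a∈ = ∈-others⁻ a∈
  ∈-successors⁻ (x ∷ y ∷ []) a∈ with x ≟ y
  ∈-successors⁻ (x ∷ y ∷ []) () | yes _
  ... | no _ = ∈-others₂⁻ a∈
  ∈-successors⁻ (x ∷ y ∷ z ∷ w) a∈ = ∈-successors⁻ (y ∷ z ∷ w) a∈

  successors-unique : ∀ {n} (w : Seq D n) → Unique (successors w)
  successors-unique []              = Unique.allFin⁺ D
  successors-unique (x ∷ [])        = others-unique x
  successors-unique (x ∷ y ∷ []) with x ≟ y
  ... | yes _  = []
  ... | no x≢y = others₂-unique x y x≢y
  successors-unique (x ∷ y ∷ z ∷ w) = successors-unique (y ∷ z ∷ w)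

  length-successors : ∀ {n} (w : Seq D n) → 2 ≤ n → Spaced w → length (successors w) ≡ m
  length-successors []         ()
  length-successors (x ∷ [])   (s≤s ())
  length-successors (x ∷ y ∷ []) _ (x≢y , _) with x ≟ y
  ... | yes x≡y = contradiction x≡y x≢y
  ... | no _    = length-others₂ x y x≢y
  length-successors (x ∷ y ∷ z ∷ w) _ (_ , s) = length-successors (y ∷ z ∷ w) (s≤s (s≤s z≤n)) s

  extend : ∀ {n} → List (Seq D n) → List (Seq D (suc n))
  extend []      = []
  extend (w ∷ X) = map (w ∷ʳ_) (successors w) ++ extend X

  ∈-extend⁺ : ∀ {n a} {w : Seq D n} {X} → w ∈ X → Spaced (w ∷ʳ a) → (w ∷ʳ a) ∈ extend X
  ∈-extend⁺ {a = a} {w} (here refl) s =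
    ∈-++⁺ˡ (∈-map⁺ (w ∷ʳ_) (∈-successors⁺ w (proj₁ s′) (proj₂ s′)))
    where
    s′ : Spaced w × Fresh a w
    s′ = spaced-∷ʳ⁻ w s
  ∈-extend⁺ {X = w′ ∷ _} (there w∈X) s = ∈-++⁺ʳ (map (w′ ∷ʳ_) (successors w′)) (∈-extend⁺ w∈X s)

  ∈-extend⁻ : ∀ {n} {v : Seq D (suc n)} {X} → v ∈ extend X →
              ∃[ w ] ∃[ a ] (w ∈ X × Fresh a w × v ≡ w ∷ʳ a)
  ∈-extend⁻ {X = w ∷ X} v∈ with ∈-++⁻ (map (w ∷ʳ_) (successors w)) v∈
  ... | inj₁ v∈w with ∈-map⁻ (w ∷ʳ_) v∈w
  ...   | a , a∈ , v≡wa = w , a , here refl , ∈-successors⁻ w a∈ , v≡wa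
  ∈-extend⁻ {X = w ∷ X} v∈ | inj₂ v∈X with ∈-extend⁻ v∈X
  ... | w′ , a , w′∈X , fresh , v≡w′a = w′ , a , there w′∈X , fresh , v≡w′a

  extend-spaced : ∀ {n} {X : List (Seq D n)} → All Spaced X → All Spaced (extend X)
  extend-spaced {X = X} X-spaced = All.tabulate spaced
    where
    spaced : ∀ {v} → v ∈ extend X → Spaced v
    spaced v∈ with ∈-extend⁻ v∈
    ... | w , a , w∈X , fresh , refl = spaced-∷ʳ⁺ w (All.lookup X-spaced w∈X) fresh

  extend-unique : ∀ {n} {X : List (Seq D n)} → Unique X → Unique (extend X)
  extend-unique {X = []}    _           = []
  extend-unique {X = w ∷ X} (w∉X ∷ X!) =
    Unique.++⁺ (Unique.map⁺ (∷ʳ-injectiveʳ w w) (successors-unique w)) (extend-unique X!) disjoint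
    where
    disjoint : Disjoint (map (w ∷ʳ_) (successors w)) (extend X)
    disjoint (v∈w , v∈X) with ∈-map⁻ (w ∷ʳ_) v∈w | ∈-extend⁻ v∈X
    ... | _ , _ , refl | w′ , _ , w′∈X , _ , eq = All.lookup w∉X w′∈X (∷ʳ-injectiveˡ w w′ eq)

  length-extend : ∀ {n c} {X : List (Seq D n)} → All (λ w → length (successors w) ≡ c) X →
                  length (extend X) ≡ c * length X
  length-extend {c = c} []                  = sym (*-zeroʳ c)
  length-extend {c = c} {w ∷ X} (|w| ∷ |X|) = begin
    length (map (w ∷ʳ_) (successors w) ++ extend X)       ≡⟨ length-++ (map (w ∷ʳ_) (successors w)) ⟩
    length (map (w ∷ʳ_) (successors w)) + length (extend X) ≡⟨ cong₂ _+_
        (trans (length-map (w ∷ʳ_) (successors w)) |w|) (length-extend |X|) ⟩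
    c + c * length X                                     ≡⟨ sym (*-suc c (length X)) ⟩
    c * suc (length X)                                   ∎
    where open ≡-Reasoning

  grow : ∀ {j n} → j ≤′ n → List (Seq D j) → List (Seq D n)
  grow ≤′-refl      X = X
  grow (≤′-step p)  X = extend (grow p X)

  ∈-grow : ∀ {j n} (p : j ≤′ n) {X} {q : Seq D j} {v : Seq D n} →
           q ∈ X → q ≼ v → Spaced v → v ∈ grow p X
  ∈-grow ≤′-refl q∈X q≼v _ = subst (_∈ _) (≼⇒≡ q≼v) q∈X
  ∈-grow (≤′-step p) {v = v} q∈X q≼v s with initLast v
  ... | w , a , refl =
    ∈-extend⁺ (∈-grow p q∈X (≼-∷ʳ⁻ w q≼v (≤′⇒≤ p)) (proj₁ (spaced-∷ʳ⁻ w s))) s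

  grow-spaced : ∀ {j n} (p : j ≤′ n) {X} → All Spaced X → All Spaced (grow p X)
  grow-spaced ≤′-refl     X-spaced = X-spaced
  grow-spaced (≤′-step p) X-spaced = extend-spaced (grow-spaced p X-spaced)

  grow-unique : ∀ {j n} (p : j ≤′ n) {X} → Unique X → Unique (grow p X)
  grow-unique ≤′-refl     X! = X!
  grow-unique (≤′-step p) X! = extend-unique (grow-unique p X!)

  length-grow : ∀ {j n} (p : j ≤′ n) {X} → 2 ≤ j → All Spaced X →
                length (grow p X) ≡ m ^ (n ∸ j) * length X
  length-grow {j} ≤′-refl {X} _ _ =
    sym (trans (cong (λ e → m ^ e * length X) (n∸n≡0 j)) (*-identityˡ (length X)))
  length-grow {j} {suc n} (≤′-step p) {X} 2≤j X-spaced = begin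
    length (extend (grow p X))    ≡⟨ length-extend (All.map (λ {w} → length-successors w 2≤n)
                                                            (grow-spaced p X-spaced)) ⟩
    m * length (grow p X)         ≡⟨ cong (m *_) (length-grow p 2≤j X-spaced) ⟩
    m * (m ^ (n ∸ j) * length X)  ≡⟨ sym (*-assoc m _ _) ⟩
    m ^ suc (n ∸ j) * length X    ≡⟨ cong (λ e → m ^ e * length X) (sym (+-∸-assoc 1 (≤′⇒≤ p))) ⟩
    m ^ (suc n ∸ j) * length X    ∎
    where
    open ≡-Reasoning
    2≤n : 2 ≤ n
    2≤n = ≤-trans 2≤j (≤′⇒≤ p)

  0≤′2 : 0 ≤′ 2
  0≤′2 = ≤′-step (≤′-step ≤′-refl)

  distinctPairs : List (Seq D 2)
  distinctPairs = grow 0≤′2 ([] ∷ [])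

  distinctPairs-spaced : All Spaced distinctPairs
  distinctPairs-spaced = grow-spaced 0≤′2 (tt ∷ [])

  distinctPairs-unique : Unique distinctPairs
  distinctPairs-unique = grow-unique 0≤′2 {[] ∷ []} ([] ∷ [])

  length-distinctPairs : length distinctPairs ≡ suc m * (D * 1)
  length-distinctPairs =
    trans (length-extend {X = extend ([] ∷ [])} (All.tabulate λ { {x ∷ []} _ → length-others x }))
          (cong (suc m *_) (length-extend {X = [] ∷ []} (length-tabulate {n = D} id ∷ [])))

  vertices : ∀ {n} → 2 ≤′ n → List (Seq D n)
  vertices p = grow p distinctPairs

  vertices-spaced : ∀ {n} (p : 2 ≤′ n) → All Spaced (vertices p)
  vertices-spaced p = grow-spaced p distinctPairs-spaced

  vertices-unique : ∀ {n} (p : 2 ≤′ n) → Unique (vertices p)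
  vertices-unique p = grow-unique p distinctPairs-unique

  length-vertices : ∀ {n} (p : 2 ≤′ n) → length (vertices p) ≡ m ^ (n ∸ 2) * (suc m * (D * 1))
  length-vertices {n} p = trans (length-grow p ≤-refl distinctPairs-spaced)
                            (cong (m ^ (n ∸ 2) *_) length-distinctPairs)

  dominated⇒∈ : ∀ {n} {S : List (Seq D (suc n))} {v} →
                Dominated 3 S v → v ∈ S ++ extend (map tail S)
  dominated⇒∈ dom with find dom
  ... | s , s∈S , inj₁ refl = ∈-++⁺ˡ s∈S
  ... | s , s∈S , inj₂ arc with arc-target arc
  ...   | a , refl = ∈-++⁺ʳ _ (∈-extend⁺ (∈-map⁺ tail s∈S)
                                          (constrained⇒spaced _ (proj₁ (proj₂ arc))))

  length-dominated : ∀ {n} {S : List (Seq D (suc n))} → 2 ≤ n → All Spaced S →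
                     length (S ++ extend (map tail S)) ≡ suc m * length S
  length-dominated {S = S} 2≤n S-spaced = begin
    length (S ++ extend (map tail S))      ≡⟨ length-++ S ⟩
    length S + length (extend (map tail S)) ≡⟨ cong (length S +_) (length-extend tails-successors) ⟩
    length S + m * length (map tail S)     ≡⟨ cong (λ l → length S + m * l) (length-map tail S) ⟩
    suc m * length S                       ∎
    where
    open ≡-Reasoning
    tails-successors : All (λ w → length (successors w) ≡ m) (map tail S)
    tails-successors = All.map⁺ (All.map (λ { {_ ∷ w} (_ , s) → length-successors w 2≤n s }) S-spaced)

  lowerBound : ∀ {n} → 3 ≤ n → DominationNumberAtLeast D 3 n (D * m ^ (n ∸ 2))
  lowerBound {suc n} (s≤s 2≤n) S (S-constrained , _ , dominates) = *-cancelˡ-≤ (suc m) (begin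
    suc m * (D * m ^ (n ∸ 1))             ≡⟨ rearrange m (m ^ (n ∸ 1)) ⟩
    m ^ (n ∸ 1) * (suc m * (D * 1))       ≡⟨ length-vertices p ⟨
    length (vertices p)                   ≤⟨ unique-⊆⇒length≤ (vertices-unique p) vertices⊆ ⟩
    length (S ++ extend (map tail S))     ≡⟨ length-dominated 2≤n (All.map (constrained⇒spaced _) S-constrained) ⟩
    suc m * length S                      ∎)
    where
    open ≤-Reasoning
    p : 2 ≤′ suc n
    p = ≤⇒≤′ (m≤n⇒m≤1+n 2≤n)
    rearrange : ∀ m x → suc m * (suc (suc m) * x) ≡ x * (suc m * (suc (suc m) * 1))
    rearrange = solve-∀
    vertices⊆ : vertices p ⊆ S ++ extend (map tail S)
    vertices⊆ {v} v∈ = dominated⇒∈ (dominates v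
      (spaced⇒constrained v (All.lookup (vertices-spaced p) v∈)))

  module Paired (σ : Fin D → Fin D) (σ-involutive : ∀ i → σ (σ i) ≡ i) where

    σ-pair : Fin D → Seq D 2
    σ-pair a = a ∷ σ a ∷ []

    ∈-σ-pairs : ∀ {a b A} → a ∈ A → b ≡ σ a → (a ∷ b ∷ []) ∈ map σ-pair A
    ∈-σ-pairs a∈A refl = ∈-map⁺ σ-pair a∈A

    σ-pairs-spaced : ∀ {A} → (∀ {a} → a ∈ A → σ a ≢ a) → All Spaced (map σ-pair A)
    σ-pairs-spaced σ-moves = All.map⁺ (All.tabulate λ a∈A → ≢-sym (σ-moves a∈A) , tt , tt)

    σ-pairs-unique : ∀ {A} → Unique A → Unique (map σ-pair A)
    σ-pairs-unique = Unique.map⁺ (cong head)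

    module FixedPointFree (σ-moves : ∀ i → σ i ≢ i) where

      evenSet : ∀ {n} → 2 ≤′ n → List (Seq D n)
      evenSet p = grow p (map σ-pair (allFin D))

      σ-pairs-allFin-spaced : All Spaced (map σ-pair (allFin D))
      σ-pairs-allFin-spaced = σ-pairs-spaced λ {a} _ → σ-moves a

      dominated-evenSet : ∀ {k} (p : 2 ≤′ suc (suc (suc k))) (w : Seq D (suc (suc k))) a →
                          Spaced (w ∷ʳ a) → Dominated 3 (evenSet p) (w ∷ʳ a)
      dominated-evenSet p (x ∷ y ∷ w) a s with y ≟ σ x
      ... | yes refl = dominated-by-self (∈-grow p (∈-σ-pairs (∈-allFin x) refl) (∷≼ (∷≼ []≼)) s)
      ... | no y≢σx  = dominated-via-arc
              (∈-grow p (∈-σ-pairs (∈-allFin (σ x)) (sym (σ-involutive x))) (∷≼ (∷≼ []≼)) s′)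
              (prepend-arc s′ s)
        where
        s′ : Spaced (σ x ∷ x ∷ y ∷ w)
        s′ = (σ-moves x , ≢-sym y≢σx) , proj₁ (spaced-∷ʳ⁻ (x ∷ y ∷ w) s)

      evenSet-isDominatingSet : ∀ {k} (p : 2 ≤′ suc (suc (suc k))) →
                                IsDominatingSet D 3 _ (evenSet p)
      evenSet-isDominatingSet p = isDominatingSet (grow-spaced p σ-pairs-allFin-spaced)
        (grow-unique p (σ-pairs-unique (Unique.allFin⁺ D))) (dominated-evenSet p)

      length-evenSet : ∀ {n} (p : 2 ≤′ n) → length (evenSet p) ≡ m ^ (n ∸ 2) * D
      length-evenSet {n} p = trans (length-grow p ≤-refl σ-pairs-allFin-spaced)
        (cong (m ^ (n ∸ 2) *_) (trans (length-map σ-pair (allFin D)) (length-tabulate {n = D} id)))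

    module OneFixedPoint (z : Fin D) (σ-fixes-z : σ z ≡ z)
                         (σ-moves : ∀ {i} → i ≢ z → σ i ≢ i) where

      σ-avoids-z : ∀ {i} → i ≢ z → σ i ≢ z
      σ-avoids-z {i} i≢z σi≡z = i≢z (trans (sym (σ-involutive i)) (trans (cong σ σi≡z) σ-fixes-z))

      triple : Fin D → Seq D 3
      triple y = σ y ∷ z ∷ y ∷ []

      oddBase : List (Seq D 3)
      oddBase = extend (map σ-pair (others z)) ++ map triple (others z)

      σ-pairs-others-spaced : All Spaced (map σ-pair (others z))
      σ-pairs-others-spaced = σ-pairs-spaced (σ-moves ∘ ∈-others⁻)

      oddBase-spaced : All Spaced oddBase
      oddBase-spaced = All.++⁺ (extend-spaced σ-pairs-others-spaced) (All.map⁺ (All.tabulate spaced))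
        where
        spaced : ∀ {y} → y ∈ others z → Spaced (triple y)
        spaced {y} y∈ = (σ-avoids-z y≢z , σ-moves y≢z) , ≢-sym y≢z , tt , tt
          where
          y≢z : y ≢ z
          y≢z = ∈-others⁻ y∈

      oddBase-unique : Unique oddBase
      oddBase-unique = Unique.++⁺ (extend-unique (σ-pairs-unique (others-unique z)))
        (Unique.map⁺ (cong (head ∘ tail ∘ tail)) (others-unique z)) disjoint
        where
        disjoint : Disjoint (extend (map σ-pair (others z))) (map triple (others z))
        disjoint (v∈pairs , v∈triples)
          with ∈-extend⁻ {X = map σ-pair (others z)} v∈pairs | ∈-map⁻ triple v∈triples
        ... | w , _ , w∈ , _ , refl | _ , _ , eq with ∈-map⁻ σ-pair w∈
        ...   | a , a∈ , refl = σ-avoids-z (∈-others⁻ a∈) (cong (head ∘ tail) eq)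

      length-oddBase : length oddBase ≡ m * suc m + suc m
      length-oddBase = begin
        length oddBase
          ≡⟨ length-++ (extend (map σ-pair (others z))) ⟩
        length (extend (map σ-pair (others z))) + length (map triple (others z))
          ≡⟨ cong₂ _+_ (length-extend (All.map (λ {w} → length-successors w ≤-refl) σ-pairs-others-spaced))
                       (length-map triple (others z)) ⟩
        m * length (map σ-pair (others z)) + length (others z)
          ≡⟨ cong₂ (λ l l′ → m * l + l′) (trans (length-map σ-pair (others z)) (length-others z))
                                           (length-others z) ⟩
        m * suc m + suc m
          ∎
        where open ≡-Reasoning

      oddSet : ∀ {n} → 3 ≤′ n → List (Seq D n)
      oddSet p = grow p oddBase

      prefix₃ : ∀ {n x y c} {v : Seq D n} → (x ∷ y ∷ c ∷ []) ≼ (x ∷ y ∷ c ∷ v)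
      prefix₃ = ∷≼ (∷≼ (∷≼ []≼))

      dominated-oddSet : ∀ {k} (p : 3 ≤′ suc (suc (suc (suc k)))) (w : Seq D (suc (suc (suc k)))) a →
                         Spaced (w ∷ʳ a) → Dominated 3 (oddSet p) (w ∷ʳ a)
      dominated-oddSet p (x ∷ y ∷ c ∷ w) a s with x ≟ z
      ... | yes refl = dominated-via-arc
              (∈-grow p (∈-++⁺ʳ _ (∈-map⁺ triple (∈-others⁺ y≢z))) prefix₃ s′)
              (prepend-arc s′ s)
        where
        y≢z : y ≢ z
        y≢z = ≢-sym (proj₁ (proj₁ s))
        s′ : Spaced (σ y ∷ z ∷ y ∷ c ∷ w)
        s′ = (σ-avoids-z y≢z , σ-moves y≢z) , proj₁ (spaced-∷ʳ⁻ (z ∷ y ∷ c ∷ w) s)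
      ... | no x≢z with y ≟ σ x
      ...   | yes refl = dominated-by-self (∈-grow p
                (∈-++⁺ˡ (∈-extend⁺ (∈-σ-pairs (∈-others⁺ x≢z) refl) (spaced-≼ prefix₃ s)))
                prefix₃ s)
      ...   | no y≢σx  = dominated-via-arc (∈-grow p
                (∈-++⁺ˡ (∈-extend⁺ (∈-σ-pairs (∈-others⁺ (σ-avoids-z x≢z)) (sym (σ-involutive x)))
                                    (spaced-≼ prefix₃ s′)))
                prefix₃ s′)
              (prepend-arc s′ s)
        where
        s′ : Spaced (σ x ∷ x ∷ y ∷ c ∷ w)
        s′ = (σ-moves x≢z , ≢-sym y≢σx) , proj₁ (spaced-∷ʳ⁻ (x ∷ y ∷ c ∷ w) s)

      oddSet-isDominatingSet : ∀ {k} (p : 3 ≤′ suc (suc (suc (suc k)))) →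
                               IsDominatingSet D 3 _ (oddSet p)
      oddSet-isDominatingSet p = isDominatingSet (grow-spaced p oddBase-spaced)
        (grow-unique p oddBase-unique) (dominated-oddSet p)

      length-oddSet : ∀ {n} (p : 3 ≤′ n) → length (oddSet p) ≡ m ^ (n ∸ 3) * (m * suc m + suc m)
      length-oddSet {n} p = trans (length-grow p (s≤s (s≤s z≤n)) oddBase-spaced)
                              (cong (m ^ (n ∸ 3) *_) length-oddBase)

swapPairs : ∀ k → Fin (k * 2) → Fin (k * 2)
swapPairs (suc k) zero          = suc zero
swapPairs (suc k) (suc zero)    = zero
swapPairs (suc k) (suc (suc i)) = suc (suc (swapPairs k i))

swapPairs-involutive : ∀ k i → swapPairs k (swapPairs k i) ≡ i
swapPairs-involutive (suc k) zero          = refl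
swapPairs-involutive (suc k) (suc zero)    = refl
swapPairs-involutive (suc k) (suc (suc i)) = cong (λ j → suc (suc j)) (swapPairs-involutive k i)

swapPairs-≢ : ∀ k i → swapPairs k i ≢ i
swapPairs-≢ (suc k) zero          ()
swapPairs-≢ (suc k) (suc zero)    ()
swapPairs-≢ (suc k) (suc (suc i)) eq = swapPairs-≢ k i (Fin-suc-injective (Fin-suc-injective eq))

FixedPointFreeInvolution : ℕ → Set
FixedPointFreeInvolution k =
  Σ (Fin k → Fin k) λ σ → (∀ i → σ (σ i) ≡ i) × (∀ i → σ i ≢ i)

even⇒fixedPointFreeInvolution : ∀ {k} → 2 ∣ k → FixedPointFreeInvolution k
even⇒fixedPointFreeInvolution (divides q refl) = swapPairs q , swapPairs-involutive q , swapPairs-≢ q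

fixZero : ∀ {k} → (Fin k → Fin k) → Fin (suc k) → Fin (suc k)
fixZero τ zero    = zero
fixZero τ (suc i) = suc (τ i)

fixZero-involutive : ∀ {k} {τ : Fin k → Fin k} → (∀ i → τ (τ i) ≡ i) → ∀ i → fixZero τ (fixZero τ i) ≡ i
fixZero-involutive τ-involutive zero    = refl
fixZero-involutive τ-involutive (suc i) = cong suc (τ-involutive i)

fixZero-moves : ∀ {k} {τ : Fin k → Fin k} → (∀ i → τ i ≢ i) → ∀ {i} → i ≢ zero → fixZero τ i ≢ i
fixZero-moves τ-moves {zero}  0≢0 = contradiction refl 0≢0
fixZero-moves τ-moves {suc i} _   = τ-moves i ∘ Fin-suc-injective

2∣-or-2∣suc : ∀ k → 2 ∣ k ⊎ 2 ∣ suc k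
2∣-or-2∣suc zero = inj₁ (divides 0 refl)
2∣-or-2∣suc (suc k) with 2∣-or-2∣suc k
... | inj₁ (divides q refl) = inj₂ (divides (suc q) refl)
... | inj₂ 2∣1+k            = inj₁ 2∣1+k

¬2∣suc⇒2∣ : ∀ {k} → ¬ 2 ∣ suc k → 2 ∣ k
¬2∣suc⇒2∣ {k} ¬2∣1+k = [ id , (λ 2∣1+k → contradiction 2∣1+k ¬2∣1+k) ]′ (2∣-or-2∣suc k)

theorem9 : (d n : ℕ) → 3 ≤ d → 4 ≤ n →
    (2 ∣ d → DominationNumberIs d 3 n (d * (d ∸ 2) ^ (n ∸ 2))) ×
    (¬ (2 ∣ d) →
      DominationNumberAtLeast d 3 n (d * (d ∸ 2) ^ (n ∸ 2)) ×
      DominationNumberAtMost d 3 n ((d ∸ 1) ^ 2 * (d ∸ 2) ^ (n ∸ 3)) ×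
      ((d ∸ 1) ^ 2 * (d ∸ 2) ^ (n ∸ 3) ≡ d * (d ∸ 2) ^ (n ∸ 2) + (d ∸ 2) ^ (n ∸ 3)))
theorem9 (suc (suc (suc m′))) (suc (suc (suc (suc n′)))) (s≤s (s≤s (s≤s z≤n))) (s≤s (s≤s (s≤s (s≤s z≤n)))) =
  evenCase , oddCase
  where
  m n : ℕ
  m = suc m′
  n = suc (suc (suc (suc n′)))
  open Sequences m

  mⁿ⁻³ : ℕ
  mⁿ⁻³ = m ^ (n ∸ 3)

  evenCase : 2 ∣ D → DominationNumberIs D 3 n (D * m ^ (n ∸ 2))
  evenCase 2∣D with even⇒fixedPointFreeInvolution 2∣D
  ... | σ , σ-involutive , σ-moves =
    (evenSet p₂ , evenSet-isDominatingSet p₂ , trans (length-evenSet p₂) (*-comm (m ^ (n ∸ 2)) D)) ,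
    lowerBound (s≤s (s≤s (s≤s z≤n)))
    where
    open Paired σ σ-involutive
    open FixedPointFree σ-moves
    p₂ : 2 ≤′ n
    p₂ = ≤⇒≤′ (s≤s (s≤s z≤n))

  oddCase : ¬ 2 ∣ D →
    DominationNumberAtLeast D 3 n (D * m ^ (n ∸ 2)) ×
    DominationNumberAtMost D 3 n (suc m ^ 2 * mⁿ⁻³) × (suc m ^ 2 * mⁿ⁻³ ≡ D * (m * mⁿ⁻³) + mⁿ⁻³)
  oddCase ¬2∣D with even⇒fixedPointFreeInvolution (¬2∣suc⇒2∣ ¬2∣D)
  ... | τ , τ-involutive , τ-moves =
    lowerBound (s≤s (s≤s (s≤s z≤n))) ,
    (oddSet p₃ , oddSet-isDominatingSet p₃ , ≤-reflexive (trans (length-oddSet p₃) (square m mⁿ⁻³))) ,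
    split m mⁿ⁻³
    where
    open Paired (fixZero τ) (fixZero-involutive τ-involutive)
    open OneFixedPoint zero refl (fixZero-moves τ-moves)
    p₃ : 3 ≤′ n
    p₃ = ≤⇒≤′ (s≤s (s≤s (s≤s z≤n)))
    square : ∀ m x → x * (m * suc m + suc m) ≡ suc m * (suc m * 1) * x
    square = solve-∀
    split : ∀ m x → suc m * (suc m * 1) * x ≡ suc (suc m) * (m * x) + x
    split = solve-∀
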